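{- For any Latin square $L$ of order $n$, $d_3(L_3(L,n))\leq n$, and equality holds if and only if $\tau(L)=n$.
   Context: A Latin square of order $n$ is an $n\times n$ array $L=(\ell_{i,j})$ with entries from $[n]$ such that no symbol appears twice in any row or column. A transversal in $L$ is a set of cells containing exactly one cell from each row, one from each column, and one cell of each symbol; $\tau(L)$ is the maximum number of pairwise disjoint transversals in $L$. The Latin square graph $L_3(L,n)$ has vertex set $\{(i,j)\mid 1\le i,j\le n\}$, with distinct $(i,j),(p,q)$ adjacent iff $i=p$ or $j=q$ or $\ell_{i,j}=\ell_{p,q}$. A set $S$ of vertices of a graph $G$ is $3$-dominating if every vertex outside $S$ has at least $3$ neighbours in $S$; the $3$-domatic number $d_3(G)$ is the maximum number of sets in a partition of $V(G)$ into $3$-dominating sets. -}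

module Defs where

open import Data.Nat using (ℕ; _≤_)
open import Data.Fin using (Fin)
open import Data.Product using (Σ; ∃; _×_; _,_)
open import Data.Sum using (_⊎_)
open import Relation.Nullary using (¬_)
open import Relation.Binary.PropositionalEquality using (_≡_; _≢_)
open import Data.Empty using (⊥)

Array : ℕ → Set
Array n = Fin n → Fin n → Fin n

IsLatin : {n : ℕ} → Array n → Set
IsLatin {n} L =
  (∀ i j j' → L i j ≡ L i j' → j ≡ j') ×
  (∀ i i' j → L i j ≡ L i' j → i ≡ i')

Cell : ℕ → Set
Cell n = Fin n × Fin n

symbol : {n : ℕ} → Array n → Cell n → Fin n
symbol L (i , j) = L i j

CellSet : ℕ → Set₁
CellSet n = Cell n → Set

ExactlyOne : (A : Set) → (A → Set) → Set
ExactlyOne A P = Σ A λ a → P a × (∀ b → P b → b ≡ a)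

IsTransversal : {n : ℕ} → Array n → CellSet n → Set
IsTransversal {n} L T =
  (∀ i → ExactlyOne (Fin n) (λ j → T (i , j))) ×
  (∀ j → ExactlyOne (Fin n) (λ i → T (i , j))) ×
  (∀ s → ExactlyOne (Cell n) (λ c → T c × symbol L c ≡ s))

HasDisjointTransversals : {n : ℕ} → Array n → ℕ → Set₁
HasDisjointTransversals {n} L k =
  Σ (Fin k → CellSet n) λ T →
    (∀ a → IsTransversal L (T a)) ×
    (∀ a b → a ≢ b → ∀ c → T a c → T b c → ⊥)

IsTau : {n : ℕ} → Array n → ℕ → Set₁
IsTau L t = HasDisjointTransversals L t × (∀ k → HasDisjointTransversals L k → k ≤ t)

-- Latin square graph L₃(L,n): vertices are cells; distinct cells adjacent iff
-- same row, same column, or same symbol.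
Adj : {n : ℕ} → Array n → Cell n → Cell n → Set
Adj L (i , j) (p , q) = ((i , j) ≢ (p , q)) × (i ≡ p ⊎ j ≡ q ⊎ L i j ≡ L p q)

Is3Dominating : {n : ℕ} → Array n → (Cell n → Set) → Set
Is3Dominating {n} L S =
  ∀ v → ¬ S v →
    Σ (Cell n) λ u₁ → Σ (Cell n) λ u₂ → Σ (Cell n) λ u₃ →
      (u₁ ≢ u₂) × (u₁ ≢ u₃) × (u₂ ≢ u₃) ×
      (S u₁ × Adj L v u₁) × (S u₂ × Adj L v u₂) × (S u₃ × Adj L v u₃)

-- A partition of V(L₃(L,n)) into k (nonempty) 3-dominating sets, given by the
-- map sending each vertex to the index of its block (surjective = no empty block).
Has3DomPartition : {n : ℕ} → Array n → ℕ → Set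
Has3DomPartition {n} L k =
  Σ (Cell n → Fin k) λ part →
    (∀ b → Σ (Cell n) λ v → part v ≡ b) ×
    (∀ b → Is3Dominating L (λ v → part v ≡ b))

IsD3 : {n : ℕ} → Array n → ℕ → Set
IsD3 L d = Has3DomPartition L d × (∀ k → Has3DomPartition L k → k ≤ d)

module Submission where

-- Let L be a Latin square of order n = m + 1.  In the Latin square graph every
-- vertex v = (i , j) has exactly 3m neighbours: m others in its row, m in its
-- column and m with its symbol, and these three groups are disjoint.
--
-- If the cells are partitioned into k + 1 blocks, each 3-dominating,
-- then v has three distinct neighbours in each of the k blocks not containing v,
-- so 3k ≤ 3m, i.e. k + 1 ≤ n.  If k = m these 3m neighbours are all neighbours of v, so no block
-- contains two adjacent cells: the partition is a proper n-colouring of the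
-- graph, and every colour class meets each row, column and symbol exactly once,
-- i.e. is a transversal.  Conversely, n disjoint transversals partition the cells
-- (in each row they occupy n distinct columns), and a transversal is 3-dominating
-- (a cell outside it sees its row-, column- and symbol-cell).  Finally, k
-- disjoint transversals occupy k distinct cells of one row, so τ(L) ≤ n.

open import Defs
open import Data.Nat using (ℕ; _≤_; zero; suc; _*_; z≤n; s≤s)
open import Data.Nat.Properties using (n<1+n; *-cancelʳ-≤)
open import Data.Fin using (Fin; zero; suc; punchOut; punchIn; combine; remQuot; _≟_)
open import Data.Fin.Properties
  using (punchOut-injective; punchIn-injective; punchInᵢ≢i; punchIn-punchOut;
         combine-injective; combine-remQuot; injective⇒≤; <⇒notInjective; any?)
open import Data.Product using (Σ; ∃; _×_; _,_; proj₁; proj₂; uncurry)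
open import Data.Product.Properties using (≡-dec)
open import Data.Sum using (_⊎_; inj₁; inj₂)
open import Data.Empty using (⊥; ⊥-elim)
open import Relation.Nullary using (¬_; yes; no; contradiction)
open import Relation.Binary.PropositionalEquality
open import Function.Bundles using (_⇔_; mk⇔)
open import Function.Definitions using (Injective)

injective⇒surjective : ∀ {n} {f : Fin n → Fin n} → Injective _≡_ _≡_ f →
                       ∀ y → ∃ λ x → f x ≡ y
injective⇒surjective {suc m} {f} inj y with any? (λ x → f x ≟ y)
... | yes found = found
... | no missed = ⊥-elim (<⇒notInjective {f = skip} (n<1+n m) skip-injective)
  where
  y≢f : ∀ x → y ≢ f x
  y≢f x e = missed (x , sym e)
  skip : Fin (suc m) → Fin m
  skip x = punchOut (y≢f x)
  skip-injective : Injective _≡_ _≡_ skip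
  skip-injective e = inj (punchOut-injective (y≢f _) (y≢f _) e)

exactlyOne-preimage : ∀ {n} {f : Fin n → Fin n} → Injective _≡_ _≡_ f →
                      ∀ y → ExactlyOne (Fin n) (λ x → f x ≡ y)
exactlyOne-preimage inj y with injective⇒surjective inj y
... | x , fx≡y = x , fx≡y , λ x' fx'≡y → inj (trans fx'≡y (sym fx≡y))

triple : {A : Set} → A → A → A → Fin 3 → A
triple a b c zero             = a
triple a b c (suc zero)       = b
triple a b c (suc (suc zero)) = c

triple-injective : {A : Set} {a b c : A} → a ≢ b → a ≢ c → b ≢ c →
                   Injective _≡_ _≡_ (triple a b c)
triple-injective ab ac bc {zero}             {zero}             _ = refl
triple-injective ab ac bc {zero}             {suc zero}         e = contradiction e ab
triple-injective ab ac bc {zero}             {suc (suc zero)}   e = contradiction e ac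
triple-injective ab ac bc {suc zero}         {zero}             e = contradiction (sym e) ab
triple-injective ab ac bc {suc zero}         {suc zero}         _ = refl
triple-injective ab ac bc {suc zero}         {suc (suc zero)}   e = contradiction e bc
triple-injective ab ac bc {suc (suc zero)}   {zero}             e = contradiction (sym e) ac
triple-injective ab ac bc {suc (suc zero)}   {suc zero}         e = contradiction (sym e) bc
triple-injective ab ac bc {suc (suc zero)}   {suc (suc zero)}   _ = refl

module _ {n : ℕ} {L : Array n} where

  3dominating-mono : {S S' : Cell n → Set} → (∀ v → S v → S' v) →
                     Is3Dominating L S → Is3Dominating L S'
  3dominating-mono S⊆S' dom v v∉S'
    with dom v (λ v∈S → v∉S' (S⊆S' v v∈S))
  ... | u₁ , u₂ , u₃ , d₁₂ , d₁₃ , d₂₃ , (s₁ , a₁) , (s₂ , a₂) , (s₃ , a₃) =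
    u₁ , u₂ , u₃ , d₁₂ , d₁₃ , d₂₃ ,
    (S⊆S' u₁ s₁ , a₁) , (S⊆S' u₂ s₂ , a₂) , (S⊆S' u₃ s₃ , a₃)

  module Dominators {S : Cell n → Set} (dom : Is3Dominating L S)
                    (v : Cell n) (v∉S : ¬ S v) where

    dominator : Fin 3 → Cell n
    dominator with dom v v∉S
    ... | u₁ , u₂ , u₃ , _ = triple u₁ u₂ u₃

    dominator-injective : Injective _≡_ _≡_ dominator
    dominator-injective with dom v v∉S
    ... | _ , _ , _ , d₁₂ , d₁₃ , d₂₃ , _ = triple-injective d₁₂ d₁₃ d₂₃

    dominator-spec : ∀ r → S (dominator r) × Adj L v (dominator r)
    dominator-spec r with dom v v∉S
    dominator-spec zero             | _ , _ , _ , _ , _ , _ , p₁ , p₂ , p₃ = p₁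
    dominator-spec (suc zero)       | _ , _ , _ , _ , _ , _ , p₁ , p₂ , p₃ = p₂
    dominator-spec (suc (suc zero)) | _ , _ , _ , _ , _ , _ , p₁ , p₂ , p₃ = p₃

  module Transversal {T : CellSet n} (tr : IsTransversal L T) where

    colIn : Fin n → Fin n
    colIn i = proj₁ (proj₁ tr i)

    colIn-∈ : ∀ i → T (i , colIn i)
    colIn-∈ i = proj₁ (proj₂ (proj₁ tr i))

    colIn-unique : ∀ {i j} → T (i , j) → j ≡ colIn i
    colIn-unique {i} {j} t = proj₂ (proj₂ (proj₁ tr i)) j t

    rowIn : Fin n → Fin n
    rowIn j = proj₁ (proj₁ (proj₂ tr) j)

    rowIn-∈ : ∀ j → T (rowIn j , j)
    rowIn-∈ j = proj₁ (proj₂ (proj₁ (proj₂ tr) j))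

    cellOf : Fin n → Cell n
    cellOf s = proj₁ (proj₂ (proj₂ tr) s)

    cellOf-∈ : ∀ s → T (cellOf s)
    cellOf-∈ s = proj₁ (proj₁ (proj₂ (proj₂ (proj₂ tr) s)))

    cellOf-symbol : ∀ s → symbol L (cellOf s) ≡ s
    cellOf-symbol s = proj₂ (proj₁ (proj₂ (proj₂ (proj₂ tr) s)))

  module DisjointTransversals {k : ℕ} (T : Fin k → CellSet n)
                              (tr : ∀ a → IsTransversal L (T a))
                              (disjoint : ∀ a b → a ≢ b → ∀ c → T a c → T b c → ⊥) where

    colIn : Fin k → Fin n → Fin n
    colIn a = Transversal.colIn (tr a)

    colIn-injective : ∀ i → Injective _≡_ _≡_ (λ a → colIn a i)
    colIn-injective i {a} {b} e with a ≟ b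
    ... | yes a≡b = a≡b
    ... | no a≢b = ⊥-elim (disjoint a b a≢b _ (Transversal.colIn-∈ (tr a) i)
                     (subst (λ j → T b (i , j)) (sym e) (Transversal.colIn-∈ (tr b) i)))

  disjointTransversals≤ : ∀ {k} → Fin n → HasDisjointTransversals L k → k ≤ n
  disjointTransversals≤ i (T , tr , disjoint) =
    injective⇒≤ (DisjointTransversals.colIn-injective T tr disjoint i)

module Latin {n : ℕ} (L : Array n) (lat : IsLatin L) where

  row-injective : ∀ i → Injective _≡_ _≡_ (L i)
  row-injective i = proj₁ lat i _ _

  col-injective : ∀ j → Injective _≡_ _≡_ (λ i → L i j)
  col-injective j = proj₂ lat _ _ j

  column : Fin n → Fin n → Fin n
  column s i = proj₁ (injective⇒surjective (row-injective i) s)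

  column-symbol : ∀ s i → L i (column s i) ≡ s
  column-symbol s i = proj₂ (injective⇒surjective (row-injective i) s)

  column-unique : ∀ {s i q} → L i q ≡ s → q ≡ column s i
  column-unique {s} {i} e = row-injective i (trans e (sym (column-symbol s i)))

  -- A transversal is 3-dominating: a cell outside it is adjacent to the
  -- transversal's cells in its row, in its column and with its symbol, and
  -- the Latin property makes these three cells distinct.
  transversal-3dominating : ∀ {T} → IsTransversal L T → Is3Dominating L T
  transversal-3dominating {T} tr (i , j) v∉T =
    u₁ , u₂ , u₃ , d₁₂ , d₁₃ , d₂₃ ,
    (colIn-∈ i , apart (colIn-∈ i) , inj₁ refl) ,
    (rowIn-∈ j , apart (rowIn-∈ j) , inj₂ (inj₁ refl)) ,
    (cellOf-∈ (L i j) , apart (cellOf-∈ (L i j)) , inj₂ (inj₂ (sym (cellOf-symbol (L i j)))))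
    where
    open Transversal tr
    u₁ u₂ u₃ : Cell n
    u₁ = i , colIn i
    u₂ = rowIn j , j
    u₃ = cellOf (L i j)
    apart : ∀ {u} → T u → (i , j) ≢ u
    apart t refl = v∉T t
    d₁₂ : u₁ ≢ u₂
    d₁₂ e = v∉T (subst (λ p → T (p , j)) (sym (cong proj₁ e)) (rowIn-∈ j))
    d₁₃ : u₁ ≢ u₃
    d₁₃ e = v∉T (subst (λ q → T (i , q)) (row-injective i symbols) (colIn-∈ i))
      where
      symbols : L i (colIn i) ≡ L i j
      symbols = trans (cong (symbol L) e) (cellOf-symbol (L i j))
    d₂₃ : u₂ ≢ u₃
    d₂₃ e = v∉T (subst (λ p → T (p , j)) (col-injective j symbols) (rowIn-∈ j))
      where
      symbols : L (rowIn j) j ≡ L i j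
      symbols = trans (cong (symbol L) e) (cellOf-symbol (L i j))

  Proper : ∀ {k} → (Cell n → Fin k) → Set
  Proper colour = ∀ u v → Adj L u v → colour u ≢ colour v

  -- Every colour class of a proper colouring with n colours is a transversal:
  -- the class meets each row, column and symbol at most once, hence (n classes,
  -- n cells per line) exactly once.
  colourClass-transversal : (colour : Cell n → Fin n) → Proper colour →
                            ∀ b → IsTransversal L (λ c → colour c ≡ b)
  colourClass-transversal colour proper b =
    (λ i → exactlyOne-preimage (inRow i) b) ,
    (λ j → exactlyOne-preimage (inColumn j) b) ,
    bySymbol
    where
    sameColour⇒equal : ∀ {i j p q} → colour (i , j) ≡ colour (p , q) →
                       (i ≡ p ⊎ j ≡ q ⊎ L i j ≡ L p q) → (i , j) ≡ (p , q)
    sameColour⇒equal {i} {j} {p} {q} same related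
      with ≡-dec _≟_ _≟_ (i , j) (p , q)
    ... | yes equal = equal
    ... | no distinct = contradiction same (proper _ _ (distinct , related))

    inRow : ∀ i → Injective _≡_ _≡_ (λ j → colour (i , j))
    inRow i same = cong proj₂ (sameColour⇒equal same (inj₁ refl))

    inColumn : ∀ j → Injective _≡_ _≡_ (λ i → colour (i , j))
    inColumn j same = cong proj₁ (sameColour⇒equal same (inj₂ (inj₁ refl)))

    inSymbol : ∀ s → Injective _≡_ _≡_ (λ i → colour (i , column s i))
    inSymbol s same = cong proj₁ (sameColour⇒equal same
      (inj₂ (inj₂ (trans (column-symbol s _) (sym (column-symbol s _))))))

    bySymbol : ∀ s → ExactlyOne (Cell n) (λ c → colour c ≡ b × symbol L c ≡ s)
    bySymbol s with exactlyOne-preimage (inSymbol s) b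
    ... | i , coloured , unique = (i , column s i) , (coloured , column-symbol s i) , onlyCell
      where
      onlyCell : ∀ c → colour c ≡ b × symbol L c ≡ s → c ≡ (i , column s i)
      onlyCell (p , q) (coloured' , q-symbol) with column-unique q-symbol
      ... | refl = cong (λ p → p , column s p) (unique p coloured')

  -- n disjoint transversals partition the cells into n 3-dominating blocks:
  -- in row i the n transversals pick n distinct columns, hence every column.
  transversals⇒partition : HasDisjointTransversals L n → Has3DomPartition L n
  transversals⇒partition (T , tr , disjoint) = block , nonempty , dominating
    where
    open DisjointTransversals T tr disjoint

    -- The block of (i , j) is the transversal whose cell in row i is (i , j).
    block : Cell n → Fin n
    block (i , j) = proj₁ (injective⇒surjective (colIn-injective i) j)

    block-spec : ∀ i j → colIn (block (i , j)) i ≡ j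
    block-spec i j = proj₂ (injective⇒surjective (colIn-injective i) j)

    T⊆block : ∀ b c → T b c → block c ≡ b
    T⊆block b (i , j) t =
      colIn-injective i (trans (block-spec i j) (Transversal.colIn-unique (tr b) t))

    nonempty : ∀ b → Σ (Cell n) λ v → block v ≡ b
    nonempty b = (b , colIn b b) , T⊆block b _ (Transversal.colIn-∈ (tr b) b)

    dominating : ∀ b → Is3Dominating L (λ v → block v ≡ b)
    dominating b = 3dominating-mono (T⊆block b) (transversal-3dominating (tr b))

module Neighbourhood {m : ℕ} (L : Array (suc m)) (lat : IsLatin L) where
  open Latin L lat

  C : Set
  C = Cell (suc m)

  -- A neighbour u of v is coded by its kind (0: same row, 1: same column,
  -- 2: same symbol) and by its row or column with v's own one punched out.
  code : (v u : C) → Adj L v u → Fin m × Fin 3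
  code (i , j) (p , q) (v≢u , _) with p ≟ i | q ≟ j
  ... | yes refl | _     = punchOut (λ j≡q → v≢u (cong (i ,_) j≡q)) , zero
  ... | no p≢i   | yes _ = punchOut (λ i≡p → p≢i (sym i≡p)) , suc zero
  ... | no p≢i   | no _  = punchOut (λ i≡p → p≢i (sym i≡p)) , suc (suc zero)

  decode : C → Fin m × Fin 3 → C
  decode (i , j) (k , zero)             = i , punchIn j k
  decode (i , j) (k , suc zero)         = punchIn i k , j
  decode (i , j) (k , suc (suc zero))   = punchIn i k , column (L i j) (punchIn i k)

  decode-code : ∀ v u (a : Adj L v u) → decode v (code v u a) ≡ u
  decode-code (i , j) (p , q) (v≢u , related) with p ≟ i | q ≟ j
  ... | yes refl | _      = cong (i ,_) (punchIn-punchOut _)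
  ... | no p≢i   | yes refl = cong (_, j) (punchIn-punchOut _)
  ... | no p≢i   | no q≢j =
    symbolNeighbour (punchIn-punchOut (λ i≡p → p≢i (sym i≡p))) (sameSymbol related)
    where
    sameSymbol : (i ≡ p ⊎ j ≡ q ⊎ L i j ≡ L p q) → L i j ≡ L p q
    sameSymbol (inj₁ i≡p)        = contradiction (sym i≡p) p≢i
    sameSymbol (inj₂ (inj₁ j≡q)) = contradiction (sym j≡q) q≢j
    sameSymbol (inj₂ (inj₂ s))   = s
    symbolNeighbour : ∀ {k} → punchIn i k ≡ p → L i j ≡ L p q →
                      decode (i , j) (k , suc (suc zero)) ≡ (p , q)
    symbolNeighbour refl s = cong (_ ,_) (sym (column-unique (sym s)))

  index : (v u : C) → Adj L v u → Fin (m * 3)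
  index v u a = uncurry combine (code v u a)

  index-injective : ∀ v {u u'} (a : Adj L v u) (a' : Adj L v u') →
                    index v u a ≡ index v u' a' → u ≡ u'
  index-injective v {u} {u'} a a' e = begin
    u                       ≡⟨ sym (decode-code v u a) ⟩
    decode v (code v u a)   ≡⟨ cong (decode v) codes ⟩
    decode v (code v u' a') ≡⟨ decode-code v u' a' ⟩
    u'                      ∎
    where
    open ≡-Reasoning
    codes : code v u a ≡ code v u' a'
    codes with combine-injective _ _ _ _ e
    ... | k≡k' , r≡r' = cong₂ _,_ k≡k' r≡r'

  -- Groups of three neighbours of v, given as an injective family over Fin t × Fin 3.
  module Groups {t : ℕ} (v : C) (f : Fin t × Fin 3 → C)
                (f-injective : Injective _≡_ _≡_ f) (f-adj : ∀ x → Adj L v (f x)) where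

    indexOf : Fin (t * 3) → Fin (m * 3)
    indexOf y = index v (f (remQuot {t} 3 y)) (f-adj _)

    indexOf-injective : Injective _≡_ _≡_ indexOf
    indexOf-injective {y} {y'} e = begin
      y                                  ≡⟨ sym (combine-remQuot {t} 3 y) ⟩
      uncurry combine (remQuot {t} 3 y)  ≡⟨ cong (uncurry combine)
                                              (f-injective (index-injective v (f-adj _) (f-adj _) e)) ⟩
      uncurry combine (remQuot {t} 3 y') ≡⟨ combine-remQuot {t} 3 y' ⟩
      y'                                 ∎
      where open ≡-Reasoning

    groups≤ : t ≤ m
    groups≤ = *-cancelʳ-≤ t m 3 (injective⇒≤ indexOf-injective)

  groups-exhaust : (v : C) (f : Fin m × Fin 3 → C) → Injective _≡_ _≡_ f →
                   (f-adj : ∀ x → Adj L v (f x)) →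
                   ∀ {u} → Adj L v u → ∃ λ x → f x ≡ u
  groups-exhaust v f f-injective f-adj {u} a
    with injective⇒surjective indexOf-injective (index v u a)
    where open Groups v f f-injective f-adj
  ... | y , e = remQuot {m} 3 y , index-injective v (f-adj _) a e

  -- In a partition into k + 1 3-dominating blocks, a vertex v has three
  -- distinct neighbours in each of the k blocks other than its own.
  module Partition {k : ℕ} (part : C → Fin (suc k))
                   (dom : ∀ b → Is3Dominating L (λ v → part v ≡ b)) (v : C) where

    otherBlock : Fin k → Fin (suc k)
    otherBlock c = punchIn (part v) c

    v∉otherBlock : ∀ c → ¬ (part v ≡ otherBlock c)
    v∉otherBlock c e = punchInᵢ≢i (part v) c (sym e)

    neighbourIn : Fin k × Fin 3 → C
    neighbourIn (c , r) = Dominators.dominator (dom (otherBlock c)) v (v∉otherBlock c) r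

    neighbourIn-spec : ∀ x → part (neighbourIn x) ≡ otherBlock (proj₁ x) × Adj L v (neighbourIn x)
    neighbourIn-spec (c , r) = Dominators.dominator-spec (dom (otherBlock c)) v (v∉otherBlock c) r

    neighbourIn-injective : Injective _≡_ _≡_ neighbourIn
    neighbourIn-injective {c , r} {c' , r'} e
      with punchIn-injective (part v) c c'
             (trans (sym (proj₁ (neighbourIn-spec (c , r))))
                    (trans (cong part e) (proj₁ (neighbourIn-spec (c' , r')))))
    ... | refl = cong (c ,_)
                   (Dominators.dominator-injective (dom (otherBlock c)) v (v∉otherBlock c) e)

    open Groups v neighbourIn neighbourIn-injective (λ x → proj₂ (neighbourIn-spec x)) public

  partition≤ : ∀ {k} → Has3DomPartition L k → k ≤ suc m
  partition≤ {zero}  _                 = z≤n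
  partition≤ {suc k} (part , _ , dom) = s≤s (Partition.groups≤ part dom (zero , zero))

  maxPartition-proper : (part : C → Fin (suc m)) →
                        (∀ b → Is3Dominating L (λ v → part v ≡ b)) → Proper part
  maxPartition-proper part dom v u a same = v∉otherBlock c (begin
    part v            ≡⟨ same ⟩
    part u            ≡⟨ cong part (sym (proj₂ hit)) ⟩
    part (neighbourIn (c , r)) ≡⟨ proj₁ (neighbourIn-spec (c , r)) ⟩
    otherBlock c      ∎)
    where
    open Partition part dom v
    open ≡-Reasoning
    hit : ∃ λ x → neighbourIn x ≡ u
    hit = groups-exhaust v neighbourIn neighbourIn-injective (λ x → proj₂ (neighbourIn-spec x)) a
    c : Fin m
    c = proj₁ (proj₁ hit)
    r : Fin 3
    r = proj₂ (proj₁ hit)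

  -- d₃ = n forces τ = n: the blocks of a maximum partition are disjoint transversals.
  maxPartition⇒transversals : IsD3 L (suc m) → IsTau L (suc m)
  maxPartition⇒transversals ((part , _ , dom) , _) =
    ((λ b c → part c ≡ b) , colourClass-transversal part (maxPartition-proper part dom) ,
     (λ a b a≢b c in-a in-b → a≢b (trans (sym in-a) in-b))) ,
    (λ _ → disjointTransversals≤ zero)

  transversals⇒maxPartition : IsTau L (suc m) → IsD3 L (suc m)
  transversals⇒maxPartition (transversals , _) =
    transversals⇒partition transversals , λ _ → partition≤

theorem2p3 : (n : ℕ) → 1 ≤ n → (L : Array n) → IsLatin L →
    (∀ d → IsD3 L d → d ≤ n) × (IsD3 L n ⇔ IsTau L n)
theorem2p3 (suc m) _ L lat =
  (λ _ (partition , _) → partition≤ partition) ,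
  mk⇔ maxPartition⇒transversals transversals⇒maxPartition
  where open Neighbourhood L lat
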